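{- Let $\mathcal X=\{0,1\}^n$ with Hamming distance $d$, let $g_0,\dots,g_n\ge0$, $\gamma(t)=\sum_{i=t}^ng_i$, and $\lambda_G(x,y)=\frac12\sum_{z\in\mathcal X}|\gamma(d(x,z))-\gamma(d(y,z))|$, which depends only on $w=d(x,y)$. Then $$\lambda_G(w)=\sum_{k=0}^n\hat\lambda_{G,k}K_k^{(n)}(w),$$ where $\hat\lambda_{G,0}=\frac1{2^{2n}}\sum_{x,y\in\mathcal X}\lambda_G(x,y)$ and $\hat\lambda_{G,k}=-2^{ -n}\sum_{t=0}^{n-1}\big(K_t^{(n-1)}(k-1)\big)^2g_t$ for $k\ge1$.
   Context: Krawtchouk polynomials: $K_k^{(m)}(x)=\sum_{i=0}^k(-1)^i\binom xi\binom{m-x}{k-i}$.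
   Formalization: The weights $g_0,\dots,g_n$ are nonnegative rationals rather than reals. -}

module Defs where

open import Data.Bool using (Bool; true; false)
open import Data.Nat as ℕ using (ℕ; zero; suc; _∸_; _≤_)
open import Data.Nat.Combinatorics using (_C_)
open import Data.Integer as ℤ using (ℤ; +_)
open import Data.Rational using (ℚ; 0ℚ; 1ℚ; ½; _+_; _*_; _-_; -_; ∣_∣; _/_)
open import Data.List using (List; []; _∷_; map; _++_; concatMap)
open import Data.Vec using (Vec; []; _∷_)

Σ< : ℕ → (ℕ → ℚ) → ℚ
Σ< zero    f = 0ℚ
Σ< (suc n) f = Σ< n f + f n

-- Σ_{i=a}^{b} f i  (empty if a > b)
Σ[_⋯_] : ℕ → ℕ → (ℕ → ℚ) → ℚ
Σ[ a ⋯ b ] f = Σ< (suc b ∸ a) (λ j → f (a ℕ.+ j))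

Σlist : {A : Set} → List A → (A → ℚ) → ℚ
Σlist []       f = 0ℚ
Σlist (x ∷ xs) f = f x + Σlist xs f

Cube : ℕ → Set
Cube n = Vec Bool n

allCube : (n : ℕ) → List (Cube n)
allCube zero    = [] ∷ []
allCube (suc n) = map (false ∷_) (allCube n) ++ map (true ∷_) (allCube n)

ham : {n : ℕ} → Cube n → Cube n → ℕ
ham []       []       = 0
ham (a ∷ x) (b ∷ y) with a Data.Bool.xor b
... | true  = suc (ham x y)
... | false = ham x y

½^ : ℕ → ℚ
½^ zero    = 1ℚ
½^ (suc n) = ½ * ½^ n

sgn : ℕ → ℤ
sgn zero    = + 1
sgn (suc i) = ℤ.- sgn i

-- Krawtchouk polynomial K_k^{(m)}(x) = Σ_{i=0}^k (-1)^i C(x,i) C(m-x,k-i)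
-- (used only for 0 ≤ x ≤ m, so truncated subtraction m ∸ x is exact)
K : (m k x : ℕ) → ℤ
K m zero    x = + (x C 0) ℤ.* + ((m ∸ x) C 0)
K m (suc k) x = K' (suc k)
  where
  term : ℕ → ℤ
  term i = sgn i ℤ.* (+ (x C i) ℤ.* + ((m ∸ x) C (suc k ∸ i)))
  K' : ℕ → ℤ
  K' zero    = term 0
  K' (suc j) = K' j ℤ.+ term (suc j)

ℤ→ℚ : ℤ → ℚ
ℤ→ℚ z = z / 1

γ : (n : ℕ) → (ℕ → ℚ) → ℕ → ℚ
γ n g t = Σ[ t ⋯ n ] g

λG : (n : ℕ) → (ℕ → ℚ) → Cube n → Cube n → ℚ
λG n g x y = ½ * Σlist (allCube n) (λ z → ∣ γ n g (ham x z) - γ n g (ham y z) ∣)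

λhat0 : (n : ℕ) → (ℕ → ℚ) → ℚ
λhat0 n g = ½^ (n ℕ.+ n) * Σlist (allCube n) (λ x → Σlist (allCube n) (λ y → λG n g x y))

λhat : (n : ℕ) → (ℕ → ℚ) → ℕ → ℚ
λhat n g zero    = λhat0 n g
λhat n g (suc k) = - (½^ n * Σ< n (λ t → ℤ→ℚ (K (n ∸ 1) t k) * ℤ→ℚ (K (n ∸ 1) t k) * g t))

{-# OPTIONS --safe #-}
module Submission where

-- Since g ≥ 0, γ is antitone, so |γ(a) − γ(b)| = Σ_{t<n} g_t [exactly one of a, b is ≤ t].  Summing over z
-- gives λ_G(x,y) = Σ_t g_t (V_t − O_t(x,y)), where V_t is the volume of a Hamming ball of radius t and
-- O_t(x,y) the size of the intersection of the radius-t balls around x and y.  By the correlation theorem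
-- for the Fourier transform on {0,1}ⁿ, O_t(x,y) = 2⁻ⁿ Σ_u B̂_t(u)² χ_u(x ⊕ y), where B̂_t is the transform
-- of the ball indicator.  The transform of a radial function h(|z|) is Σ_k h(k) K_k^{(n)}(|u|); for the
-- ball the partial sums of the K_k^{(n)} telescope, so B̂_t(u) = V_t if u = 0 and K_t^{(n-1)}(|u| − 1)
-- otherwise.  Hence O_t is again a Krawtchouk expansion in d(x,y); collecting the coefficient of
-- K_k^{(n)}(d(x,y)) gives λ̂_{G,k} for k ≥ 1, and averaging over x and y identifies the constant term.

open import Defs
open import Algebra.Bundles using (CommutativeMonoid)
import Algebra.Properties.CommutativeSemigroup as CommSemigroupProperties
open import Data.Bool using (Bool; true; false; _∧_; _xor_; T)
open import Data.Bool.Properties using (xor-comm; ∧-zeroʳ)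
open import Data.Integer as ℤ using (ℤ)
open import Data.Integer.Tactic.RingSolver using (solve-∀)
open import Data.List using (List; []; _∷_; map; _++_)
open import Data.Nat as ℕ using (ℕ; zero; suc; _∸_; _≤_; _<_; _≤ᵇ_; z≤n; s≤s)
open import Data.Nat.Combinatorics using (_C_; nCk+nC[k+1]≡[n+1]C[k+1]; k>n⇒nCk≡0)
import Data.Nat.Properties as ℕₚ
open import Data.Rational using (ℚ; 0ℚ; 1ℚ; ½; _+_; _*_; _-_; -_; ∣_∣; toℚᵘ)
open import Data.Rational using () renaming (_≤_ to _≤ℚ_)
import Data.Rational.Properties as ℚₚ
open import Data.Rational.Solver using (module +-*-Solver)
open import Data.Rational.Unnormalised using (mkℚᵘ; *≡*) renaming (_≃_ to _≃ᵘ_)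
import Data.Rational.Unnormalised.Properties as ℚᵘₚ
open import Data.Sum using (inj₁; inj₂)
open import Data.Vec using ([]; _∷_; zipWith; replicate)
open import Data.Vec.Properties using (zipWith-comm)
open import Function using (_∘_)
open import Relation.Binary.PropositionalEquality
open import Relation.Nullary using (yes; no)
open ≡-Reasoning

module +-Props = CommSemigroupProperties (CommutativeMonoid.commutativeSemigroup ℚₚ.+-0-commutativeMonoid)
module *-Props = CommSemigroupProperties (CommutativeMonoid.commutativeSemigroup ℚₚ.*-1-commutativeMonoid)

-- Finite sums as linear functionals

record IsLinear {A : Set} (S : (A → ℚ) → ℚ) : Set where
  field
    cong-pointwise : ∀ {f g} → (∀ a → f a ≡ g a) → S f ≡ S g
    +-distrib      : ∀ f g → S (λ a → f a + g a) ≡ S f + S g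
    *-distribˡ     : ∀ c f → S (λ a → c * f a) ≡ c * S f

  *-distribʳ : ∀ c f → S (λ a → f a * c) ≡ S f * c
  *-distribʳ c f = begin
    S (λ a → f a * c)  ≡⟨ cong-pointwise (λ a → ℚₚ.*-comm (f a) c) ⟩
    S (λ a → c * f a)  ≡⟨ *-distribˡ c f ⟩
    c * S f            ≡⟨ ℚₚ.*-comm c (S f) ⟩
    S f * c            ∎

  zero-const : S (λ _ → 0ℚ) ≡ 0ℚ
  zero-const = begin
    S (λ _ → 0ℚ)        ≡⟨ cong-pointwise (λ _ → sym (ℚₚ.*-zeroˡ 0ℚ)) ⟩
    S (λ _ → 0ℚ * 0ℚ)   ≡⟨ *-distribˡ 0ℚ (λ _ → 0ℚ) ⟩
    0ℚ * S (λ _ → 0ℚ)   ≡⟨ ℚₚ.*-zeroˡ (S (λ _ → 0ℚ)) ⟩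
    0ℚ                  ∎

  neg-distrib : ∀ f → S (λ a → - f a) ≡ - S f
  neg-distrib f = begin
    S (λ a → - f a)       ≡⟨ cong-pointwise (λ a → neg≡-1* (f a)) ⟩
    S (λ a → - 1ℚ * f a)  ≡⟨ *-distribˡ (- 1ℚ) f ⟩
    - 1ℚ * S f            ≡⟨ neg≡-1* (S f) ⟨
    - S f                 ∎
    where
    neg≡-1* : ∀ p → - p ≡ - 1ℚ * p
    neg≡-1* p = trans (cong -_ (sym (ℚₚ.*-identityˡ p))) (ℚₚ.neg-distribˡ-* 1ℚ p)

  −-distrib : ∀ f g → S (λ a → f a - g a) ≡ S f - S g
  −-distrib f g = trans (+-distrib f (λ a → - g a)) (cong (S f +_) (neg-distrib g))

Σlist-isLinear : {A : Set} (xs : List A) → IsLinear (Σlist xs)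
Σlist-isLinear xs = record
  { cong-pointwise = λ f≗g → ext xs f≗g
  ; +-distrib      = +-distrib xs
  ; *-distribˡ     = *-distribˡ xs
  }
  where
  ext : ∀ {A} (xs : List A) {f g : A → ℚ} → (∀ a → f a ≡ g a) → Σlist xs f ≡ Σlist xs g
  ext []       f≗g = refl
  ext (x ∷ xs) f≗g = cong₂ _+_ (f≗g x) (ext xs f≗g)
  +-distrib : ∀ {A} (xs : List A) f g → Σlist xs (λ a → f a + g a) ≡ Σlist xs f + Σlist xs g
  +-distrib []       f g = refl
  +-distrib (x ∷ xs) f g =
    trans (cong (f x + g x +_) (+-distrib xs f g)) (+-Props.interchange (f x) (g x) _ _)
  *-distribˡ : ∀ {A} (xs : List A) c f → Σlist xs (λ a → c * f a) ≡ c * Σlist xs f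
  *-distribˡ []       c f = sym (ℚₚ.*-zeroʳ c)
  *-distribˡ (x ∷ xs) c f =
    trans (cong (c * f x +_) (*-distribˡ xs c f)) (sym (ℚₚ.*-distribˡ-+ c (f x) _))

Σ<-isLinear : (n : ℕ) → IsLinear (Σ< n)
Σ<-isLinear n = record
  { cong-pointwise = λ f≗g → ext n f≗g
  ; +-distrib      = +-distrib n
  ; *-distribˡ     = *-distribˡ n
  }
  where
  ext : ∀ n {f g : ℕ → ℚ} → (∀ a → f a ≡ g a) → Σ< n f ≡ Σ< n g
  ext zero    f≗g = refl
  ext (suc n) f≗g = cong₂ _+_ (ext n f≗g) (f≗g n)
  +-distrib : ∀ n f g → Σ< n (λ a → f a + g a) ≡ Σ< n f + Σ< n g
  +-distrib zero    f g = refl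
  +-distrib (suc n) f g =
    trans (cong (_+ (f n + g n)) (+-distrib n f g)) (+-Props.interchange (Σ< n f) (Σ< n g) (f n) (g n))
  *-distribˡ : ∀ n c f → Σ< n (λ a → c * f a) ≡ c * Σ< n f
  *-distribˡ zero    c f = sym (ℚₚ.*-zeroʳ c)
  *-distribˡ (suc n) c f =
    trans (cong (_+ c * f n) (*-distribˡ n c f)) (sym (ℚₚ.*-distribˡ-+ c _ (f n)))

module Σ< (n : ℕ) = IsLinear (Σ<-isLinear n)

Σlist-swap : ∀ {A B : Set} {S : (B → ℚ) → ℚ} → IsLinear S → (xs : List A) (f : A → B → ℚ) →
  Σlist xs (λ a → S (f a)) ≡ S (λ b → Σlist xs (λ a → f a b))
Σlist-swap         S-lin []       f = sym (IsLinear.zero-const S-lin)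
Σlist-swap {S = S} S-lin (x ∷ xs) f =
  trans (cong (S (f x) +_) (Σlist-swap S-lin xs f)) (sym (IsLinear.+-distrib S-lin (f x) _))

Σ<-swap : ∀ {B : Set} {S : (B → ℚ) → ℚ} → IsLinear S → (n : ℕ) (f : ℕ → B → ℚ) →
  Σ< n (λ a → S (f a)) ≡ S (λ b → Σ< n (λ a → f a b))
Σ<-swap         S-lin zero    f = sym (IsLinear.zero-const S-lin)
Σ<-swap {S = S} S-lin (suc n) f =
  trans (cong (_+ S (f n)) (Σ<-swap S-lin n f)) (sym (IsLinear.+-distrib S-lin _ (f n)))

Σ<-cong-< : ∀ n {f g : ℕ → ℚ} → (∀ i → i < n → f i ≡ g i) → Σ< n f ≡ Σ< n g
Σ<-cong-< zero    f≗g = refl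
Σ<-cong-< (suc n) f≗g = cong₂ _+_ (Σ<-cong-< n (λ i i<n → f≗g i (ℕₚ.m<n⇒m<1+n i<n))) (f≗g n ℕₚ.≤-refl)

Σ<-suc : ∀ n f → Σ< (suc n) f ≡ f 0 + Σ< n (λ i → f (suc i))
Σ<-suc zero    f = trans (ℚₚ.+-identityˡ (f 0)) (sym (ℚₚ.+-identityʳ (f 0)))
Σ<-suc (suc n) f = trans (cong (_+ f (suc n)) (Σ<-suc n f)) (ℚₚ.+-assoc (f 0) _ _)

Σ<-nonneg : ∀ n {f : ℕ → ℚ} → (∀ i → i < n → 0ℚ ≤ℚ f i) → 0ℚ ≤ℚ Σ< n f
Σ<-nonneg zero    f≥0 = ℚₚ.≤-refl
Σ<-nonneg (suc n) f≥0 =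
  ℚₚ.+-mono-≤ (Σ<-nonneg n (λ i i<n → f≥0 i (ℕₚ.m<n⇒m<1+n i<n))) (f≥0 n ℕₚ.≤-refl)

Σlist-++ : ∀ {A : Set} (xs ys : List A) f → Σlist (xs ++ ys) f ≡ Σlist xs f + Σlist ys f
Σlist-++ []       ys f = sym (ℚₚ.+-identityˡ _)
Σlist-++ (x ∷ xs) ys f = trans (cong (f x +_) (Σlist-++ xs ys f)) (sym (ℚₚ.+-assoc (f x) _ _))

Σlist-map : ∀ {A B : Set} (h : A → B) (xs : List A) f → Σlist (map h xs) f ≡ Σlist xs (f ∘ h)
Σlist-map h []       f = refl
Σlist-map h (x ∷ xs) f = cong (f (h x) +_) (Σlist-map h xs f)

-- The cube {0,1}ⁿ

Σcube : (n : ℕ) → (Cube n → ℚ) → ℚ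
Σcube n = Σlist (allCube n)

module Σcube (n : ℕ) = IsLinear (Σlist-isLinear (allCube n))

Σcube-∷ : ∀ n (f : Cube (suc n) → ℚ) →
  Σcube (suc n) f ≡ Σcube n (λ z → f (false ∷ z)) + Σcube n (λ z → f (true ∷ z))
Σcube-∷ n f = trans (Σlist-++ (map (false ∷_) (allCube n)) _ f)
  (cong₂ _+_ (Σlist-map (false ∷_) (allCube n) f) (Σlist-map (true ∷_) (allCube n) f))

_⊕_ : ∀ {n} → Cube n → Cube n → Cube n
_⊕_ = zipWith _xor_

Σcube-translate : ∀ n (x : Cube n) f → Σcube n (λ z → f (x ⊕ z)) ≡ Σcube n f
Σcube-translate zero    []          f = refl
Σcube-translate (suc n) (false ∷ x) f = begin
  Σcube (suc n) (λ z → f ((false ∷ x) ⊕ z))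
    ≡⟨ Σcube-∷ n _ ⟩
  Σcube n (λ z → f (false ∷ x ⊕ z)) + Σcube n (λ z → f (true ∷ x ⊕ z))
    ≡⟨ cong₂ _+_ (Σcube-translate n x (f ∘ (false ∷_))) (Σcube-translate n x (f ∘ (true ∷_))) ⟩
  Σcube n (λ z → f (false ∷ z)) + Σcube n (λ z → f (true ∷ z))
    ≡⟨ Σcube-∷ n f ⟨
  Σcube (suc n) f ∎
Σcube-translate (suc n) (true ∷ x) f = begin
  Σcube (suc n) (λ z → f ((true ∷ x) ⊕ z))
    ≡⟨ Σcube-∷ n _ ⟩
  Σcube n (λ z → f (true ∷ x ⊕ z)) + Σcube n (λ z → f (false ∷ x ⊕ z))
    ≡⟨ cong₂ _+_ (Σcube-translate n x (f ∘ (true ∷_))) (Σcube-translate n x (f ∘ (false ∷_))) ⟩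
  Σcube n (λ z → f (true ∷ z)) + Σcube n (λ z → f (false ∷ z))
    ≡⟨ ℚₚ.+-comm (Σcube n (λ z → f (true ∷ z))) _ ⟩
  Σcube n (λ z → f (false ∷ z)) + Σcube n (λ z → f (true ∷ z))
    ≡⟨ Σcube-∷ n f ⟨
  Σcube (suc n) f ∎

½^-Σcube-1 : ∀ n → ½^ n * Σcube n (λ _ → 1ℚ) ≡ 1ℚ
½^-Σcube-1 zero    = refl
½^-Σcube-1 (suc n) = begin
  ½ * ½^ n * Σcube (suc n) (λ _ → 1ℚ)                   ≡⟨ cong (½ * ½^ n *_) (Σcube-∷ n _) ⟩
  ½ * ½^ n * (Σcube n (λ _ → 1ℚ) + Σcube n (λ _ → 1ℚ))  ≡⟨ halve (½^ n) (Σcube n (λ _ → 1ℚ)) ⟩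
  ½^ n * Σcube n (λ _ → 1ℚ)                             ≡⟨ ½^-Σcube-1 n ⟩
  1ℚ                                                    ∎
  where
  halve : ∀ h s → ½ * h * (s + s) ≡ h * s
  halve = solve 2 (λ h s → con ½ :* h :* (s :+ s) := h :* s) refl
    where open +-*-Solver

½^-+ : ∀ a b → ½^ (a ℕ.+ b) ≡ ½^ a * ½^ b
½^-+ zero    b = sym (ℚₚ.*-identityˡ _)
½^-+ (suc a) b = trans (cong (½ *_) (½^-+ a b)) (sym (ℚₚ.*-assoc ½ (½^ a) (½^ b)))

wt : ∀ {n} → Cube n → ℕ
wt []          = 0
wt (false ∷ z) = wt z
wt (true ∷ z)  = suc (wt z)

wt-≤ : ∀ {n} (z : Cube n) → wt z ≤ n
wt-≤ []          = z≤n
wt-≤ (false ∷ z) = ℕₚ.m≤n⇒m≤1+n (wt-≤ z)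
wt-≤ (true ∷ z)  = s≤s (wt-≤ z)

wt-replicate : ∀ n → wt (replicate n false) ≡ 0
wt-replicate zero    = refl
wt-replicate (suc n) = wt-replicate n

ham≡wt⊕ : ∀ {n} (x y : Cube n) → ham x y ≡ wt (x ⊕ y)
ham≡wt⊕ []      []      = refl
ham≡wt⊕ (a ∷ x) (b ∷ y) with a xor b
... | true  = cong suc (ham≡wt⊕ x y)
... | false = ham≡wt⊕ x y

ham-comm : ∀ {n} (x y : Cube n) → ham x y ≡ ham y x
ham-comm x y = trans (ham≡wt⊕ x y) (trans (cong wt (zipWith-comm xor-comm x y)) (sym (ham≡wt⊕ y x)))

ham-≤ : ∀ {n} (x y : Cube n) → ham x y ≤ n
ham-≤ x y = subst (_≤ _) (sym (ham≡wt⊕ x y)) (wt-≤ (x ⊕ y))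

Σcube-ham : ∀ n (x : Cube n) (f : ℕ → ℚ) → Σcube n (λ z → f (ham x z)) ≡ Σcube n (λ z → f (wt z))
Σcube-ham n x f = trans (Σcube.cong-pointwise n (λ z → cong f (ham≡wt⊕ x z))) (Σcube-translate n x (f ∘ wt))

-- Krawtchouk polynomials

Kℚ : ℕ → ℕ → ℕ → ℚ
Kℚ m k x = ℤ→ℚ (K m k x)

-- The i-th term of K_k^{(a+x)}(x).  Parametrising by a = m − x keeps truncated subtraction out of both
-- Pascal recurrences below.
kterm : (a x k i : ℕ) → ℤ
kterm a x k i = sgn i ℤ.* (ℤ.+ (x C i) ℤ.* ℤ.+ (a C (k ∸ i)))

krawtchouk : (a x k : ℕ) → ℚ
krawtchouk a x k = Σ< (suc k) (λ i → ℤ→ℚ (kterm a x k i))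

Σᶻ : ℕ → (ℕ → ℤ) → ℤ
Σᶻ zero    t = t 0
Σᶻ (suc j) t = Σᶻ j t ℤ.+ t (suc j)

-- K accumulates its terms in a local function of Defs that cannot be named here.  Kfold is that function,
-- found by unification: once the outer index suc k is abstracted, K m (suc (suc k)) x unfolds to the local
-- function applied to distinct variables, a pattern.
mutual
  Kfold : (m p x j : ℕ) → ℤ → ℤ → ℤ
  Kfold = _

  K-unfold : ∀ m k x → K m (suc (suc k)) x ≡
    Kfold m (suc k) x k (kterm (m ∸ x) x (suc (suc k)) (suc k)) (kterm (m ∸ x) x (suc (suc k)) (suc (suc k)))
  K-unfold m k x with kterm (m ∸ x) x (suc (suc k)) (suc k) | kterm (m ∸ x) x (suc (suc k)) (suc (suc k))
  ... | a | b with suc k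
  ... | p = refl

Kfold≡Σᶻ : ∀ m p x j a b → Kfold m p x j a b ≡ (Σᶻ j (kterm (m ∸ x) x (suc p)) ℤ.+ a) ℤ.+ b
Kfold≡Σᶻ m p x zero    a b = refl
Kfold≡Σᶻ m p x (suc j) a b = cong (ℤ._+ b) (Kfold≡Σᶻ m p x j (kterm (m ∸ x) x (suc p) (suc j)) a)

K≡Σᶻ : ∀ m k x → K m (suc k) x ≡ Σᶻ (suc k) (kterm (m ∸ x) x (suc k))
K≡Σᶻ m zero    x = refl
K≡Σᶻ m (suc k) x = trans (K-unfold m k x) (Kfold≡Σᶻ m (suc k) x k _ _)

-- ℤ→ℚ z is definitionally fromℚᵘ (mkℚᵘ z 0), so additivity is inherited from ℚᵘ.
ℤ→ℚ-+ : ∀ a b → ℤ→ℚ (a ℤ.+ b) ≡ ℤ→ℚ a + ℤ→ℚ b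
ℤ→ℚ-+ a b = trans (ℚₚ.fromℚᵘ-cong sum≃) (ℚₚ.fromℚᵘ-toℚᵘ (ℤ→ℚ a + ℤ→ℚ b))
  where
  over1 : ∀ a b → (a ℤ.+ b) ℤ.* ℤ.+ 1 ≡ (a ℤ.* ℤ.+ 1 ℤ.+ b ℤ.* ℤ.+ 1) ℤ.* ℤ.+ 1
  over1 = solve-∀
  sum≃ : mkℚᵘ (a ℤ.+ b) 0 ≃ᵘ toℚᵘ (ℤ→ℚ a + ℤ→ℚ b)
  sum≃ = ℚᵘₚ.≃-trans (*≡* (over1 a b))
    (ℚᵘₚ.≃-trans (ℚᵘₚ.+-cong (ℚᵘₚ.≃-sym (ℚₚ.toℚᵘ-fromℚᵘ (mkℚᵘ a 0)))
                              (ℚᵘₚ.≃-sym (ℚₚ.toℚᵘ-fromℚᵘ (mkℚᵘ b 0))))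
                 (ℚᵘₚ.≃-sym (ℚₚ.toℚᵘ-homo-+ (ℤ→ℚ a) (ℤ→ℚ b))))

ℤ→ℚ-Σᶻ : ∀ j t → ℤ→ℚ (Σᶻ j t) ≡ Σ< (suc j) (λ i → ℤ→ℚ (t i))
ℤ→ℚ-Σᶻ zero    t = sym (ℚₚ.+-identityˡ _)
ℤ→ℚ-Σᶻ (suc j) t = trans (ℤ→ℚ-+ (Σᶻ j t) (t (suc j))) (cong (_+ ℤ→ℚ (t (suc j))) (ℤ→ℚ-Σᶻ j t))

Kℚ≡krawtchouk : ∀ m k x → Kℚ m k x ≡ krawtchouk (m ∸ x) x k
Kℚ≡krawtchouk m zero    x = refl
Kℚ≡krawtchouk m (suc k) x = trans (cong ℤ→ℚ (K≡Σᶻ m k x)) (ℤ→ℚ-Σᶻ (suc k) _)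

kterm-pascalᵃ : ∀ a x k i → i ≤ k → kterm (suc a) x (suc k) i ≡ kterm a x (suc k) i ℤ.+ kterm a x k i
kterm-pascalᵃ a x k i i≤k = begin
  s ℤ.* (c ℤ.* ℤ.+ (suc a C (suc k ∸ i)))
    ≡⟨ cong (λ j → s ℤ.* (c ℤ.* ℤ.+ (suc a C j))) (ℕₚ.+-∸-assoc 1 i≤k) ⟩
  s ℤ.* (c ℤ.* ℤ.+ (suc a C suc (k ∸ i)))
    ≡⟨ cong (λ b → s ℤ.* (c ℤ.* ℤ.+ b)) (nCk+nC[k+1]≡[n+1]C[k+1] a (k ∸ i)) ⟨
  s ℤ.* (c ℤ.* (ℤ.+ (a C (k ∸ i)) ℤ.+ ℤ.+ (a C suc (k ∸ i))))
    ≡⟨ distrib s c (ℤ.+ (a C (k ∸ i))) (ℤ.+ (a C suc (k ∸ i))) ⟩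
  s ℤ.* (c ℤ.* ℤ.+ (a C suc (k ∸ i))) ℤ.+ kterm a x k i
    ≡⟨ cong (λ j → s ℤ.* (c ℤ.* ℤ.+ (a C j)) ℤ.+ kterm a x k i) (ℕₚ.+-∸-assoc 1 i≤k) ⟨
  kterm a x (suc k) i ℤ.+ kterm a x k i ∎
  where
  s c : ℤ
  s = sgn i
  c = ℤ.+ (x C i)
  distrib : ∀ s c p q → s ℤ.* (c ℤ.* (p ℤ.+ q)) ≡ s ℤ.* (c ℤ.* q) ℤ.+ s ℤ.* (c ℤ.* p)
  distrib = solve-∀

kterm-pascalˣ : ∀ a x k i → kterm a (suc x) (suc k) (suc i) ℤ.+ kterm a x k i ≡ kterm a x (suc k) (suc i)
kterm-pascalˣ a x k i = begin
  ℤ.- s ℤ.* (ℤ.+ (suc x C suc i) ℤ.* c) ℤ.+ s ℤ.* (ℤ.+ (x C i) ℤ.* c)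
    ≡⟨ cong (λ b → ℤ.- s ℤ.* (ℤ.+ b ℤ.* c) ℤ.+ s ℤ.* (ℤ.+ (x C i) ℤ.* c)) (nCk+nC[k+1]≡[n+1]C[k+1] x i) ⟨
  ℤ.- s ℤ.* ((ℤ.+ (x C i) ℤ.+ ℤ.+ (x C suc i)) ℤ.* c) ℤ.+ s ℤ.* (ℤ.+ (x C i) ℤ.* c)
    ≡⟨ cancel s (ℤ.+ (x C i)) (ℤ.+ (x C suc i)) c ⟩
  ℤ.- s ℤ.* (ℤ.+ (x C suc i) ℤ.* c) ∎
  where
  s c : ℤ
  s = sgn i
  c = ℤ.+ (a C (k ∸ i))
  cancel : ∀ s p q c → ℤ.- s ℤ.* ((p ℤ.+ q) ℤ.* c) ℤ.+ s ℤ.* (p ℤ.* c) ≡ ℤ.- s ℤ.* (q ℤ.* c)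
  cancel = solve-∀

kterm-vanish : ∀ a x i → kterm a x (suc (a ℕ.+ x)) i ≡ ℤ.+ 0
kterm-vanish a x i with i ℕₚ.≤? x
... | yes i≤x = trans (cong (λ b → sgn i ℤ.* (ℤ.+ (x C i) ℤ.* ℤ.+ b)) (k>n⇒nCk≡0 a<))
                      (zeroʳ (sgn i) (ℤ.+ (x C i)))
  where
  a< : a < suc (a ℕ.+ x) ∸ i
  a< = ℕₚ.<-≤-trans (ℕₚ.≤-reflexive (sym (ℕₚ.m+n∸n≡m (suc a) x))) (ℕₚ.∸-monoʳ-≤ (suc (a ℕ.+ x)) i≤x)
  zeroʳ : ∀ s c → s ℤ.* (c ℤ.* ℤ.+ 0) ≡ ℤ.+ 0
  zeroʳ = solve-∀
... | no i≰x = trans (cong (λ b → sgn i ℤ.* (ℤ.+ b ℤ.* c)) (k>n⇒nCk≡0 (ℕₚ.≰⇒> i≰x))) (zeroˡ (sgn i) c)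
  where
  c : ℤ
  c = ℤ.+ (a C (suc (a ℕ.+ x) ∸ i))
  zeroˡ : ∀ s c → s ℤ.* (ℤ.+ 0 ℤ.* c) ≡ ℤ.+ 0
  zeroˡ = solve-∀

krawtchouk-pascalᵃ : ∀ a x k → krawtchouk (suc a) x (suc k) ≡ krawtchouk a x (suc k) + krawtchouk a x k
krawtchouk-pascalᵃ a x k = begin
  Σ< (suc k) T′ + T′ (suc k)
    ≡⟨ cong₂ _+_ (trans (Σ<-cong-< (suc k) split) (Σ<.+-distrib (suc k) T₁ T₀)) top ⟩
  Σ< (suc k) T₁ + Σ< (suc k) T₀ + T₁ (suc k)
    ≡⟨ +-Props.xy∙z≈xz∙y (Σ< (suc k) T₁) (Σ< (suc k) T₀) (T₁ (suc k)) ⟩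
  Σ< (suc k) T₁ + T₁ (suc k) + Σ< (suc k) T₀ ∎
  where
  T′ T₁ T₀ : ℕ → ℚ
  T′ i = ℤ→ℚ (kterm (suc a) x (suc k) i)
  T₁ i = ℤ→ℚ (kterm a x (suc k) i)
  T₀ i = ℤ→ℚ (kterm a x k i)
  split : ∀ i → i < suc k → T′ i ≡ T₁ i + T₀ i
  split i (s≤s i≤k) =
    trans (cong ℤ→ℚ (kterm-pascalᵃ a x k i i≤k)) (ℤ→ℚ-+ (kterm a x (suc k) i) (kterm a x k i))
  top : T′ (suc k) ≡ T₁ (suc k)
  top = cong (λ j → ℤ→ℚ (sgn (suc k) ℤ.* (ℤ.+ (x C suc k) ℤ.* ℤ.+ j)))
             (trans (cong (suc a C_) (ℕₚ.n∸n≡0 k)) (sym (cong (a C_) (ℕₚ.n∸n≡0 k))))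

krawtchouk-pascalˣ : ∀ a x k → krawtchouk a (suc x) (suc k) + krawtchouk a x k ≡ krawtchouk a x (suc k)
krawtchouk-pascalˣ a x k = begin
  krawtchouk a (suc x) (suc k) + Σ< (suc k) T₀
    ≡⟨ cong (_+ Σ< (suc k) T₀) (Σ<-suc (suc k) T′) ⟩
  T′ 0 + Σ< (suc k) (T′ ∘ suc) + Σ< (suc k) T₀
    ≡⟨ ℚₚ.+-assoc (T′ 0) _ _ ⟩
  T′ 0 + (Σ< (suc k) (T′ ∘ suc) + Σ< (suc k) T₀)
    ≡⟨ cong (T′ 0 +_) (trans (sym (Σ<.+-distrib (suc k) (T′ ∘ suc) T₀)) (Σ<.cong-pointwise (suc k) merge)) ⟩
  T₁ 0 + Σ< (suc k) (T₁ ∘ suc)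
    ≡⟨ Σ<-suc (suc k) T₁ ⟨
  krawtchouk a x (suc k) ∎
  where
  T′ T₁ T₀ : ℕ → ℚ
  T′ i = ℤ→ℚ (kterm a (suc x) (suc k) i)
  T₁ i = ℤ→ℚ (kterm a x (suc k) i)
  T₀ i = ℤ→ℚ (kterm a x k i)
  merge : ∀ i → T′ (suc i) + T₀ i ≡ T₁ (suc i)
  merge i = trans (sym (ℤ→ℚ-+ (kterm a (suc x) (suc k) (suc i)) (kterm a x k i)))
                  (cong ℤ→ℚ (kterm-pascalˣ a x k i))

krawtchouk-vanish : ∀ a x → krawtchouk a x (suc (a ℕ.+ x)) ≡ 0ℚ
krawtchouk-vanish a x =
  trans (Σ<.cong-pointwise (suc (suc (a ℕ.+ x))) (λ i → cong ℤ→ℚ (kterm-vanish a x i)))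
        (Σ<.zero-const (suc (suc (a ℕ.+ x))))

Kℚ-pascalᵐ : ∀ {m x} k → x ≤ m → Kℚ (suc m) (suc k) x ≡ Kℚ m (suc k) x + Kℚ m k x
Kℚ-pascalᵐ {m} {x} k x≤m = begin
  Kℚ (suc m) (suc k) x
    ≡⟨ Kℚ≡krawtchouk (suc m) (suc k) x ⟩
  krawtchouk (suc m ∸ x) x (suc k)
    ≡⟨ cong (λ a → krawtchouk a x (suc k)) (ℕₚ.+-∸-assoc 1 x≤m) ⟩
  krawtchouk (suc (m ∸ x)) x (suc k)
    ≡⟨ krawtchouk-pascalᵃ (m ∸ x) x k ⟩
  krawtchouk (m ∸ x) x (suc k) + krawtchouk (m ∸ x) x k
    ≡⟨ cong₂ _+_ (Kℚ≡krawtchouk m (suc k) x) (Kℚ≡krawtchouk m k x) ⟨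
  Kℚ m (suc k) x + Kℚ m k x ∎

Kℚ-pascalˣ : ∀ m k x → Kℚ (suc m) (suc k) (suc x) + Kℚ m k x ≡ Kℚ m (suc k) x
Kℚ-pascalˣ m k x = begin
  Kℚ (suc m) (suc k) (suc x) + Kℚ m k x
    ≡⟨ cong₂ _+_ (Kℚ≡krawtchouk (suc m) (suc k) (suc x)) (Kℚ≡krawtchouk m k x) ⟩
  krawtchouk (m ∸ x) (suc x) (suc k) + krawtchouk (m ∸ x) x k
    ≡⟨ krawtchouk-pascalˣ (m ∸ x) x k ⟩
  krawtchouk (m ∸ x) x (suc k)
    ≡⟨ Kℚ≡krawtchouk m (suc k) x ⟨
  Kℚ m (suc k) x ∎

Kℚ-vanish : ∀ {n w} → w ≤ n → Kℚ n (suc n) w ≡ 0ℚ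
Kℚ-vanish {n} {w} w≤n = begin
  Kℚ n (suc n) w                            ≡⟨ Kℚ≡krawtchouk n (suc n) w ⟩
  krawtchouk (n ∸ w) w (suc n)              ≡⟨ cong (λ j → krawtchouk (n ∸ w) w (suc j)) (ℕₚ.m∸n+n≡m w≤n) ⟨
  krawtchouk (n ∸ w) w (suc (n ∸ w ℕ.+ w))  ≡⟨ krawtchouk-vanish (n ∸ w) w ⟩
  0ℚ                                        ∎

Σ<-Kℚ-telescope : ∀ m t w → Σ< (suc t) (λ k → Kℚ (suc m) k (suc w)) ≡ Kℚ m t w
Σ<-Kℚ-telescope m zero    w = refl
Σ<-Kℚ-telescope m (suc t) w = begin
  Σ< (suc t) (λ k → Kℚ (suc m) k (suc w)) + Kℚ (suc m) (suc t) (suc w)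
    ≡⟨ cong (_+ Kℚ (suc m) (suc t) (suc w)) (Σ<-Kℚ-telescope m t w) ⟩
  Kℚ m t w + Kℚ (suc m) (suc t) (suc w)
    ≡⟨ ℚₚ.+-comm (Kℚ m t w) _ ⟩
  Kℚ (suc m) (suc t) (suc w) + Kℚ m t w
    ≡⟨ Kℚ-pascalˣ m t w ⟩
  Kℚ m (suc t) w ∎

-- Fourier analysis on the cube

sign : Bool → ℚ
sign false = 1ℚ
sign true  = - 1ℚ

-- χ u z = (-1)^(u·z).  The bit of z is the first argument of _∧_, so χ u (b ∷ z) unfolds for a literal b.
χ : ∀ {n} → Cube n → Cube n → ℚ
χ []      []      = 1ℚ
χ (c ∷ u) (b ∷ z) = sign (b ∧ c) * χ u z

χ-zero : ∀ {n} (z : Cube n) → χ (replicate n false) z ≡ 1ℚ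
χ-zero []      = refl
χ-zero (b ∷ z) = cong₂ _*_ (cong sign (∧-zeroʳ b)) (χ-zero z)

𝓕 : (n : ℕ) → (Cube n → ℚ) → Cube n → ℚ
𝓕 n F u = Σcube n (λ z → F z * χ u z)

𝓕-isLinear : ∀ n (u : Cube n) → IsLinear (λ F → 𝓕 n F u)
𝓕-isLinear n u = record
  { cong-pointwise = λ F≗G → Σcube.cong-pointwise n (λ z → cong (_* χ u z) (F≗G z))
  ; +-distrib      = λ F G → trans (Σcube.cong-pointwise n (λ z → ℚₚ.*-distribʳ-+ (χ u z) (F z) (G z)))
                                   (Σcube.+-distrib n _ _)
  ; *-distribˡ     = λ c F → trans (Σcube.cong-pointwise n (λ z → ℚₚ.*-assoc c (F z) (χ u z)))
                                   (Σcube.*-distribˡ n c _)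
  }

module 𝓕 (n : ℕ) (u : Cube n) = IsLinear (𝓕-isLinear n u)

𝓕-∷ : ∀ n (F : Cube (suc n) → ℚ) c u →
  𝓕 (suc n) F (c ∷ u) ≡ 𝓕 n (λ z → F (false ∷ z)) u + sign c * 𝓕 n (λ z → F (true ∷ z)) u
𝓕-∷ n F c u = trans (Σcube-∷ n _) (cong₂ _+_
  (Σcube.cong-pointwise n (λ z → cong (F (false ∷ z) *_) (ℚₚ.*-identityˡ (χ u z))))
  (trans (Σcube.cong-pointwise n (λ z → *-Props.x∙yz≈y∙xz (F (true ∷ z)) (sign c) (χ u z)))
         (Σcube.*-distribˡ n (sign c) _)))

𝓕-∷-combine : ∀ n (H : Cube (suc n) → ℚ) c v →
  𝓕 n (λ u → H (false ∷ u) + sign c * H (true ∷ u)) v ≡ 𝓕 (suc n) H (c ∷ v)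
𝓕-∷-combine n H c v = begin
  𝓕 n (λ u → H (false ∷ u) + sign c * H (true ∷ u)) v
    ≡⟨ 𝓕.+-distrib n v (λ u → H (false ∷ u)) _ ⟩
  𝓕 n (λ u → H (false ∷ u)) v + 𝓕 n (λ u → sign c * H (true ∷ u)) v
    ≡⟨ cong (𝓕 n (λ u → H (false ∷ u)) v +_) (𝓕.*-distribˡ n v (sign c) (λ u → H (true ∷ u))) ⟩
  𝓕 n (λ u → H (false ∷ u)) v + sign c * 𝓕 n (λ u → H (true ∷ u)) v
    ≡⟨ 𝓕-∷ n H c v ⟨
  𝓕 (suc n) H (c ∷ v) ∎

𝓕-zero : ∀ n F → 𝓕 n F (replicate n false) ≡ Σcube n F
𝓕-zero n F = Σcube.cong-pointwise n (λ z → trans (cong (F z *_) (χ-zero z)) (ℚₚ.*-identityʳ (F z)))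

Kℚ-wt-∷ : ∀ {n} c (v : Cube n) k →
  Kℚ (suc n) (suc k) (wt (c ∷ v)) ≡ Kℚ n (suc k) (wt v) + sign c * Kℚ n k (wt v)
Kℚ-wt-∷ {n} false v k =
  trans (Kℚ-pascalᵐ k (wt-≤ v)) (cong (Kℚ n (suc k) (wt v) +_) (sym (ℚₚ.*-identityˡ (Kℚ n k (wt v)))))
Kℚ-wt-∷ {n} true v k = begin
  X                                ≡⟨ isolate X K₀ ⟩
  X + K₀ + - 1ℚ * K₀               ≡⟨ cong (_+ - 1ℚ * K₀) (Kℚ-pascalˣ n k (wt v)) ⟩
  Kℚ n (suc k) (wt v) + - 1ℚ * K₀  ∎
  where
  X K₀ : ℚ
  X  = Kℚ (suc n) (suc k) (suc (wt v))
  K₀ = Kℚ n k (wt v)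
  isolate : ∀ p q → p ≡ p + q + - 1ℚ * q
  isolate = solve 2 (λ p q → p := p :+ q :+ con (- 1ℚ) :* q) refl
    where open +-*-Solver

Σ<-Kℚ-vanishingTop : ∀ n (h : ℕ → ℚ) {w} → w ≤ n →
  Σ< (suc (suc n)) (λ k → h k * Kℚ n k w) ≡ Σ< (suc n) (λ k → h k * Kℚ n k w)
Σ<-Kℚ-vanishingTop n h {w} w≤n = begin
  S + h (suc n) * Kℚ n (suc n) w   ≡⟨ cong (λ K → S + h (suc n) * K) (Kℚ-vanish w≤n) ⟩
  S + h (suc n) * 0ℚ               ≡⟨ cong (S +_) (ℚₚ.*-zeroʳ (h (suc n))) ⟩
  S + 0ℚ                           ≡⟨ ℚₚ.+-identityʳ S ⟩
  S                                ∎
  where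
  S : ℚ
  S = Σ< (suc n) (λ k → h k * Kℚ n k w)

Σ<-Kℚ-∷ : ∀ n (h : ℕ → ℚ) c (v : Cube n) →
  Σ< (suc (suc n)) (λ k → h k * Kℚ (suc n) k (wt (c ∷ v)))
    ≡ Σ< (suc n) (λ k → h k * Kℚ n k (wt v)) + sign c * Σ< (suc n) (λ k → h (suc k) * Kℚ n k (wt v))
Σ<-Kℚ-∷ n h c v = begin
  Σ< (suc (suc n)) (λ k → h k * Kℚ (suc n) k (wt (c ∷ v)))
    ≡⟨ Σ<-suc (suc n) _ ⟩
  h 0 * 1ℚ + Σ< (suc n) (λ k → h (suc k) * Kℚ (suc n) (suc k) (wt (c ∷ v)))
    ≡⟨ cong (h 0 * 1ℚ +_) (Σ<.cong-pointwise (suc n) split) ⟩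
  h 0 * 1ℚ + Σ< (suc n) (λ k → A k + sign c * B k)
    ≡⟨ cong (h 0 * 1ℚ +_) (trans (Σ<.+-distrib (suc n) A _)
                                 (cong (Σ< (suc n) A +_) (Σ<.*-distribˡ (suc n) (sign c) B))) ⟩
  h 0 * 1ℚ + (Σ< (suc n) A + sign c * Σ< (suc n) B)
    ≡⟨ ℚₚ.+-assoc (h 0 * 1ℚ) (Σ< (suc n) A) _ ⟨
  h 0 * 1ℚ + Σ< (suc n) A + sign c * Σ< (suc n) B
    ≡⟨ cong (_+ sign c * Σ< (suc n) B) (sym (Σ<-suc (suc n) (λ k → h k * Kℚ n k w))) ⟩
  Σ< (suc (suc n)) (λ k → h k * Kℚ n k w) + sign c * Σ< (suc n) B
    ≡⟨ cong (_+ sign c * Σ< (suc n) B) (Σ<-Kℚ-vanishingTop n h (wt-≤ v)) ⟩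
  Σ< (suc n) (λ k → h k * Kℚ n k w) + sign c * Σ< (suc n) B ∎
  where
  w : ℕ
  w = wt v
  A B : ℕ → ℚ
  A k = h (suc k) * Kℚ n (suc k) w
  B k = h (suc k) * Kℚ n k w
  distrib : ∀ a p s q → a * (p + s * q) ≡ a * p + s * (a * q)
  distrib = solve 4 (λ a p s q → a :* (p :+ s :* q) := a :* p :+ s :* (a :* q)) refl
    where open +-*-Solver
  split : ∀ k → h (suc k) * Kℚ (suc n) (suc k) (wt (c ∷ v)) ≡ A k + sign c * B k
  split k = trans (cong (h (suc k) *_) (Kℚ-wt-∷ c v k)) (distrib (h (suc k)) (Kℚ n (suc k) w) (sign c) (Kℚ n k w))

𝓕-radial : ∀ n (h : ℕ → ℚ) (v : Cube n) → 𝓕 n (λ z → h (wt z)) v ≡ Σ< (suc n) (λ k → h k * Kℚ n k (wt v))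
𝓕-radial zero    h []      = trans (ℚₚ.+-identityʳ (h 0 * 1ℚ)) (sym (ℚₚ.+-identityˡ (h 0 * 1ℚ)))
𝓕-radial (suc n) h (c ∷ v) = begin
  𝓕 (suc n) (λ z → h (wt z)) (c ∷ v)
    ≡⟨ 𝓕-∷ n (λ z → h (wt z)) c v ⟩
  𝓕 n (λ z → h (wt z)) v + sign c * 𝓕 n (λ z → h (suc (wt z))) v
    ≡⟨ cong₂ (λ p q → p + sign c * q) (𝓕-radial n h v) (𝓕-radial n (h ∘ suc) v) ⟩
  Σ< (suc n) (λ k → h k * Kℚ n k (wt v)) + sign c * Σ< (suc n) (λ k → h (suc k) * Kℚ n k (wt v))
    ≡⟨ Σ<-Kℚ-∷ n h c v ⟨
  Σ< (suc (suc n)) (λ k → h k * Kℚ (suc n) k (wt (c ∷ v))) ∎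

pairing-even : ∀ p q r s →
  p * r + q * s ≡ ½ * ((p + 1ℚ * q) * (r + 1ℚ * s) + 1ℚ * ((p + - 1ℚ * q) * (r + - 1ℚ * s)))
pairing-even = solve 4 (λ p q r s → p :* r :+ q :* s
  := con ½ :* ((p :+ con 1ℚ :* q) :* (r :+ con 1ℚ :* s)
               :+ con 1ℚ :* ((p :+ con (- 1ℚ) :* q) :* (r :+ con (- 1ℚ) :* s)))) refl
  where open +-*-Solver

pairing-odd : ∀ p q r s →
  p * s + q * r ≡ ½ * ((p + 1ℚ * q) * (r + 1ℚ * s) + - 1ℚ * ((p + - 1ℚ * q) * (r + - 1ℚ * s)))
pairing-odd = solve 4 (λ p q r s → p :* s :+ q :* r
  := con ½ :* ((p :+ con 1ℚ :* q) :* (r :+ con 1ℚ :* s)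
               :+ con (- 1ℚ) :* ((p :+ con (- 1ℚ) :* q) :* (r :+ con (- 1ℚ) :* s)))) refl
  where open +-*-Solver

xor-pairing : ∀ a b (A B : Bool → ℚ) →
  A (a xor false) * B (b xor false) + A (a xor true) * B (b xor true)
    ≡ ½ * ((A false + sign false * A true) * (B false + sign false * B true)
           + sign (a xor b) * ((A false + sign true * A true) * (B false + sign true * B true)))
xor-pairing false false A B = pairing-even (A false) (A true) (B false) (B true)
xor-pairing false true  A B = pairing-odd (A false) (A true) (B false) (B true)
xor-pairing true  false A B =
  trans (ℚₚ.+-comm (A true * B false) _) (pairing-odd (A false) (A true) (B false) (B true))
xor-pairing true  true  A B =
  trans (ℚₚ.+-comm (A true * B true) _) (pairing-even (A false) (A true) (B false) (B true))

Σcube-correlation : ∀ n (F G : Cube n → ℚ) (x y : Cube n) →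
  Σcube n (λ z → F (x ⊕ z) * G (y ⊕ z)) ≡ ½^ n * 𝓕 n (λ u → 𝓕 n F u * 𝓕 n G u) (x ⊕ y)
Σcube-correlation zero    F G []      []      = base (F []) (G [])
  where
  base : ∀ p q → p * q + 0ℚ ≡ 1ℚ * ((p * 1ℚ + 0ℚ) * (q * 1ℚ + 0ℚ) * 1ℚ + 0ℚ)
  base = solve 2 (λ p q → p :* q :+ con 0ℚ
    := con 1ℚ :* ((p :* con 1ℚ :+ con 0ℚ) :* (q :* con 1ℚ :+ con 0ℚ) :* con 1ℚ :+ con 0ℚ)) refl
    where open +-*-Solver
Σcube-correlation (suc n) F G (a ∷ x) (b ∷ y) = begin
  Σcube (suc n) (λ z → F ((a ∷ x) ⊕ z) * G ((b ∷ y) ⊕ z))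
    ≡⟨ Σcube-∷ n _ ⟩
  Σcube n (λ z → F ((a xor false) ∷ x ⊕ z) * G ((b xor false) ∷ y ⊕ z))
    + Σcube n (λ z → F ((a xor true) ∷ x ⊕ z) * G ((b xor true) ∷ y ⊕ z))
    ≡⟨ cong₂ _+_ (Σcube-correlation n (F∷ (a xor false)) (G∷ (b xor false)) x y)
                 (Σcube-correlation n (F∷ (a xor true)) (G∷ (b xor true)) x y) ⟩
  ½^ n * 𝓕 n (Â∙B̂ false) v + ½^ n * 𝓕 n (Â∙B̂ true) v
    ≡⟨ ℚₚ.*-distribˡ-+ (½^ n) _ _ ⟨
  ½^ n * (𝓕 n (Â∙B̂ false) v + 𝓕 n (Â∙B̂ true) v)
    ≡⟨ cong (½^ n *_) (sym (𝓕.+-distrib n v (Â∙B̂ false) (Â∙B̂ true))) ⟩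
  ½^ n * 𝓕 n (λ u → Â∙B̂ false u + Â∙B̂ true u) v
    ≡⟨ cong (½^ n *_) (𝓕.cong-pointwise n v pointwise) ⟩
  ½^ n * 𝓕 n (λ u → ½ * (H (false ∷ u) + sign (a xor b) * H (true ∷ u))) v
    ≡⟨ cong (½^ n *_) (𝓕.*-distribˡ n v ½ (λ u → H (false ∷ u) + sign (a xor b) * H (true ∷ u))) ⟩
  ½^ n * (½ * 𝓕 n (λ u → H (false ∷ u) + sign (a xor b) * H (true ∷ u)) v)
    ≡⟨ cong (λ r → ½^ n * (½ * r)) (𝓕-∷-combine n H (a xor b) v) ⟩
  ½^ n * (½ * 𝓕 (suc n) H ((a xor b) ∷ v))
    ≡⟨ *-Props.x∙yz≈y∙xz (½^ n) ½ _ ⟩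
  ½ * (½^ n * 𝓕 (suc n) H ((a xor b) ∷ v))
    ≡⟨ ℚₚ.*-assoc ½ (½^ n) _ ⟨
  ½^ (suc n) * 𝓕 (suc n) H ((a ∷ x) ⊕ (b ∷ y)) ∎
  where
  v : Cube n
  v = x ⊕ y
  F∷ G∷ Â B̂ Â∙B̂ : Bool → Cube n → ℚ
  F∷ i w = F (i ∷ w)
  G∷ i w = G (i ∷ w)
  Â i = 𝓕 n (F∷ i)
  B̂ i = 𝓕 n (G∷ i)
  Â∙B̂ i u = Â (a xor i) u * B̂ (b xor i) u
  H : Cube (suc n) → ℚ
  H u = 𝓕 (suc n) F u * 𝓕 (suc n) G u
  pointwise : ∀ u → Â∙B̂ false u + Â∙B̂ true u ≡ ½ * (H (false ∷ u) + sign (a xor b) * H (true ∷ u))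
  pointwise u = trans (xor-pairing a b (λ i → Â i u) (λ i → B̂ i u))
    (sym (cong₂ (λ p q → ½ * (p + sign (a xor b) * q))
                (cong₂ _*_ (𝓕-∷ n F false u) (𝓕-∷ n G false u))
                (cong₂ _*_ (𝓕-∷ n F true u) (𝓕-∷ n G true u))))

-- Hamming balls and λ_G

𝟙 : Bool → ℚ
𝟙 true  = 1ℚ
𝟙 false = 0ℚ

𝟙-T : ∀ {b} → T b → 𝟙 b ≡ 1ℚ
𝟙-T {true} _ = refl

𝟙-xor : ∀ p q → 𝟙 (p xor q) ≡ 𝟙 p + 𝟙 q - (1ℚ + 1ℚ) * (𝟙 p * 𝟙 q)
𝟙-xor false false = refl
𝟙-xor false true  = refl
𝟙-xor true  false = refl
𝟙-xor true  true  = refl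

𝟙-−-xor : ∀ p q → (T q → T p) → 𝟙 p - 𝟙 q ≡ 𝟙 (p xor q)
𝟙-−-xor true  true  _   = refl
𝟙-−-xor true  false _   = refl
𝟙-−-xor false false _   = refl
𝟙-−-xor false true  q⇒p with () ← q⇒p _

𝟙*-nonneg : ∀ b {c} → 0ℚ ≤ℚ c → 0ℚ ≤ℚ 𝟙 b * c
𝟙*-nonneg true  {c} 0≤c = subst (0ℚ ≤ℚ_) (sym (ℚₚ.*-identityˡ c)) 0≤c
𝟙*-nonneg false {c} _   = subst (0ℚ ≤ℚ_) (sym (ℚₚ.*-zeroˡ c)) ℚₚ.≤-refl

≤ᵇ-antitone : ∀ {a b} t → a ≤ b → T (b ≤ᵇ t) → T (a ≤ᵇ t)
≤ᵇ-antitone {a} {b} t a≤b b≤ᵇt = ℕₚ.≤⇒≤ᵇ (ℕₚ.≤-trans a≤b (ℕₚ.≤ᵇ⇒≤ b t b≤ᵇt))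

≤ᵇ-suc : ∀ a t → (suc a ≤ᵇ suc t) ≡ (a ≤ᵇ t)
≤ᵇ-suc zero    t = refl
≤ᵇ-suc (suc a) t = refl

Σ<-𝟙≥ : ∀ N a (g : ℕ → ℚ) → Σ< N (λ t → 𝟙 (a ≤ᵇ t) * g t) ≡ Σ< (N ∸ a) (λ j → g (a ℕ.+ j))
Σ<-𝟙≥ N       zero    g = Σ<.cong-pointwise N (λ t → ℚₚ.*-identityˡ (g t))
Σ<-𝟙≥ zero    (suc a) g = refl
Σ<-𝟙≥ (suc N) (suc a) g = begin
  Σ< (suc N) (λ t → 𝟙 (suc a ≤ᵇ t) * g t)
    ≡⟨ Σ<-suc N _ ⟩
  0ℚ * g 0 + Σ< N (λ t → 𝟙 (suc a ≤ᵇ suc t) * g (suc t))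
    ≡⟨ cong (0ℚ * g 0 +_) (Σ<.cong-pointwise N (λ t → cong (λ b → 𝟙 b * g (suc t)) (≤ᵇ-suc a t))) ⟩
  0ℚ * g 0 + Σ< N (λ t → 𝟙 (a ≤ᵇ t) * g (suc t))
    ≡⟨ cong₂ _+_ (ℚₚ.*-zeroˡ (g 0)) (Σ<-𝟙≥ N a (g ∘ suc)) ⟩
  0ℚ + Σ< (N ∸ a) (λ j → g (suc a ℕ.+ j))
    ≡⟨ ℚₚ.+-identityˡ _ ⟩
  Σ< (N ∸ a) (λ j → g (suc a ℕ.+ j)) ∎

Σ<-𝟙≤ : ∀ N t (f : ℕ → ℚ) → t < N → Σ< N (λ k → 𝟙 (k ≤ᵇ t) * f k) ≡ Σ< (suc t) f
Σ<-𝟙≤ (suc N) zero    f _ = begin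
  Σ< (suc N) (λ k → 𝟙 (k ≤ᵇ 0) * f k)
    ≡⟨ Σ<-suc N _ ⟩
  1ℚ * f 0 + Σ< N (λ k → 0ℚ * f (suc k))
    ≡⟨ cong₂ _+_ (ℚₚ.*-identityˡ (f 0)) (Σ<.cong-pointwise N (λ k → ℚₚ.*-zeroˡ (f (suc k)))) ⟩
  f 0 + Σ< N (λ _ → 0ℚ)
    ≡⟨ cong (f 0 +_) (Σ<.zero-const N) ⟩
  f 0 + 0ℚ
    ≡⟨ ℚₚ.+-comm (f 0) 0ℚ ⟩
  Σ< 1 f ∎
Σ<-𝟙≤ (suc N) (suc t) f (s≤s t<N) = begin
  Σ< (suc N) (λ k → 𝟙 (k ≤ᵇ suc t) * f k)
    ≡⟨ Σ<-suc N _ ⟩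
  1ℚ * f 0 + Σ< N (λ k → 𝟙 (suc k ≤ᵇ suc t) * f (suc k))
    ≡⟨ cong (1ℚ * f 0 +_) (Σ<.cong-pointwise N (λ k → cong (λ b → 𝟙 b * f (suc k)) (≤ᵇ-suc k t))) ⟩
  1ℚ * f 0 + Σ< N (λ k → 𝟙 (k ≤ᵇ t) * f (suc k))
    ≡⟨ cong₂ _+_ (ℚₚ.*-identityˡ (f 0)) (Σ<-𝟙≤ N t (f ∘ suc) t<N) ⟩
  f 0 + Σ< (suc t) (f ∘ suc)
    ≡⟨ Σ<-suc (suc t) f ⟨
  Σ< (suc (suc t)) f ∎

γ-indicator : ∀ n g {a} → a ≤ n → γ n g a ≡ Σ< n (λ t → 𝟙 (a ≤ᵇ t) * g t) + g n
γ-indicator n g {a} a≤n = begin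
  Σ< (suc n ∸ a) (λ j → g (a ℕ.+ j))         ≡⟨ Σ<-𝟙≥ (suc n) a g ⟨
  S + 𝟙 (a ≤ᵇ n) * g n                        ≡⟨ cong (λ c → S + c * g n) (𝟙-T (ℕₚ.≤⇒≤ᵇ a≤n)) ⟩
  S + 1ℚ * g n                                ≡⟨ cong (S +_) (ℚₚ.*-identityˡ (g n)) ⟩
  S + g n                                     ∎
  where
  S : ℚ
  S = Σ< n (λ t → 𝟙 (a ≤ᵇ t) * g t)

γ-difference : ∀ n g {a b} → a ≤ n → b ≤ n →
  γ n g a - γ n g b ≡ Σ< n (λ t → (𝟙 (a ≤ᵇ t) - 𝟙 (b ≤ᵇ t)) * g t)
γ-difference n g {a} {b} a≤n b≤n = begin
  γ n g a - γ n g b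
    ≡⟨ cong₂ _-_ (γ-indicator n g a≤n) (γ-indicator n g b≤n) ⟩
  (Σ< n (𝟙g a) + g n) - (Σ< n (𝟙g b) + g n)
    ≡⟨ cancel (Σ< n (𝟙g a)) (Σ< n (𝟙g b)) (g n) ⟩
  Σ< n (𝟙g a) - Σ< n (𝟙g b)
    ≡⟨ Σ<.−-distrib n (𝟙g a) (𝟙g b) ⟨
  Σ< n (λ t → 𝟙g a t - 𝟙g b t)
    ≡⟨ Σ<.cong-pointwise n (λ t → factor (𝟙 (a ≤ᵇ t)) (𝟙 (b ≤ᵇ t)) (g t)) ⟩
  Σ< n (λ t → (𝟙 (a ≤ᵇ t) - 𝟙 (b ≤ᵇ t)) * g t) ∎
  where
  open +-*-Solver
  𝟙g : ℕ → ℕ → ℚ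
  𝟙g c t = 𝟙 (c ≤ᵇ t) * g t
  cancel : ∀ p q r → (p + r) - (q + r) ≡ p - q
  cancel = solve 3 (λ p q r → (p :+ r) :- (q :+ r) := p :- q) refl
  factor : ∀ p q r → p * r - q * r ≡ (p - q) * r
  factor = solve 3 (λ p q r → p :* r :- q :* r := (p :- q) :* r) refl

∣γ-γ∣-≤ : ∀ n g → (∀ i → i ≤ n → 0ℚ ≤ℚ g i) → ∀ {a b} → a ≤ b → b ≤ n →
  ∣ γ n g a - γ n g b ∣ ≡ Σ< n (λ t → 𝟙 ((a ≤ᵇ t) xor (b ≤ᵇ t)) * g t)
∣γ-γ∣-≤ n g g≥0 {a} {b} a≤b b≤n = begin
  ∣ γ n g a - γ n g b ∣
    ≡⟨ cong ∣_∣ (γ-difference n g (ℕₚ.≤-trans a≤b b≤n) b≤n) ⟩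
  ∣ Σ< n (λ t → (𝟙 (a ≤ᵇ t) - 𝟙 (b ≤ᵇ t)) * g t) ∣
    ≡⟨ cong ∣_∣ (Σ<.cong-pointwise n (λ t → cong (_* g t) (𝟙-−-xor (p t) (q t) (≤ᵇ-antitone t a≤b)))) ⟩
  ∣ Σ< n (λ t → 𝟙 (p t xor q t) * g t) ∣
    ≡⟨ ℚₚ.0≤p⇒∣p∣≡p (Σ<-nonneg n (λ t t<n → 𝟙*-nonneg (p t xor q t) (g≥0 t (ℕₚ.<⇒≤ t<n)))) ⟩
  Σ< n (λ t → 𝟙 (p t xor q t) * g t) ∎
  where
  p q : ℕ → Bool
  p t = a ≤ᵇ t
  q t = b ≤ᵇ t

∣γ-γ∣ : ∀ n g → (∀ i → i ≤ n → 0ℚ ≤ℚ g i) → ∀ {a b} → a ≤ n → b ≤ n →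
  ∣ γ n g a - γ n g b ∣ ≡ Σ< n (λ t → 𝟙 ((a ≤ᵇ t) xor (b ≤ᵇ t)) * g t)
∣γ-γ∣ n g g≥0 {a} {b} a≤n b≤n with ℕₚ.≤-total a b
... | inj₁ a≤b = ∣γ-γ∣-≤ n g g≥0 a≤b b≤n
... | inj₂ b≤a = begin
  ∣ γ n g a - γ n g b ∣
    ≡⟨ cong ∣_∣ (swap (γ n g a) (γ n g b)) ⟩
  ∣ - (γ n g b - γ n g a) ∣
    ≡⟨ ℚₚ.∣-p∣≡∣p∣ _ ⟩
  ∣ γ n g b - γ n g a ∣
    ≡⟨ ∣γ-γ∣-≤ n g g≥0 b≤a a≤n ⟩
  Σ< n (λ t → 𝟙 ((b ≤ᵇ t) xor (a ≤ᵇ t)) * g t)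
    ≡⟨ Σ<.cong-pointwise n (λ t → cong (λ c → 𝟙 c * g t) (xor-comm (b ≤ᵇ t) (a ≤ᵇ t))) ⟩
  Σ< n (λ t → 𝟙 ((a ≤ᵇ t) xor (b ≤ᵇ t)) * g t) ∎
  where
  swap : ∀ p q → p - q ≡ - (q - p)
  swap = solve 2 (λ p q → p :- q := :- (q :- p)) refl
    where open +-*-Solver

ballVolume : ℕ → ℕ → ℚ
ballVolume n t = Σcube n (λ z → 𝟙 (wt z ≤ᵇ t))

ballOverlap : ∀ n → ℕ → Cube n → Cube n → ℚ
ballOverlap n t x y = Σcube n (λ z → 𝟙 (ham x z ≤ᵇ t) * 𝟙 (ham y z ≤ᵇ t))

ballSymDiff : ∀ n t (x y : Cube n) →
  Σcube n (λ z → 𝟙 ((ham x z ≤ᵇ t) xor (ham y z ≤ᵇ t)))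
    ≡ (1ℚ + 1ℚ) * (ballVolume n t - ballOverlap n t x y)
ballSymDiff n t x y = begin
  Σcube n (λ z → 𝟙 (p z xor q z))
    ≡⟨ Σcube.cong-pointwise n (λ z → 𝟙-xor (p z) (q z)) ⟩
  Σcube n (λ z → 𝟙 (p z) + 𝟙 (q z) - (1ℚ + 1ℚ) * (𝟙 (p z) * 𝟙 (q z)))
    ≡⟨ Σcube.−-distrib n _ _ ⟩
  Σcube n (λ z → 𝟙 (p z) + 𝟙 (q z)) - Σcube n (λ z → (1ℚ + 1ℚ) * (𝟙 (p z) * 𝟙 (q z)))
    ≡⟨ cong₂ _-_ (Σcube.+-distrib n _ _) (Σcube.*-distribˡ n (1ℚ + 1ℚ) _) ⟩
  Σcube n (𝟙 ∘ p) + Σcube n (𝟙 ∘ q) - (1ℚ + 1ℚ) * ballOverlap n t x y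
    ≡⟨ cong₂ (λ P Q → P + Q - (1ℚ + 1ℚ) * ballOverlap n t x y)
             (Σcube-ham n x (λ d → 𝟙 (d ≤ᵇ t))) (Σcube-ham n y (λ d → 𝟙 (d ≤ᵇ t))) ⟩
  ballVolume n t + ballVolume n t - (1ℚ + 1ℚ) * ballOverlap n t x y
    ≡⟨ double (ballVolume n t) (ballOverlap n t x y) ⟩
  (1ℚ + 1ℚ) * (ballVolume n t - ballOverlap n t x y) ∎
  where
  p q : Cube n → Bool
  p z = ham x z ≤ᵇ t
  q z = ham y z ≤ᵇ t
  double : ∀ v o → v + v - (1ℚ + 1ℚ) * o ≡ (1ℚ + 1ℚ) * (v - o)
  double = solve 2 (λ v o → v :+ v :- (con 1ℚ :+ con 1ℚ) :* o
                        := (con 1ℚ :+ con 1ℚ) :* (v :- o)) refl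
    where open +-*-Solver

λG-ball : ∀ n g → (∀ i → i ≤ n → 0ℚ ≤ℚ g i) → ∀ x y →
  λG n g x y ≡ Σ< n (λ t → g t * (ballVolume n t - ballOverlap n t x y))
λG-ball n g g≥0 x y = begin
  ½ * Σcube n (λ z → ∣ γ n g (ham x z) - γ n g (ham y z) ∣)
    ≡⟨ cong (½ *_) (Σcube.cong-pointwise n (λ z → ∣γ-γ∣ n g g≥0 (ham-≤ x z) (ham-≤ y z))) ⟩
  ½ * Σcube n (λ z → Σ< n (λ t → 𝟙 (p t z xor q t z) * g t))
    ≡⟨ cong (½ *_) (Σlist-swap (Σ<-isLinear n) (allCube n) _) ⟩
  ½ * Σ< n (λ t → Σcube n (λ z → 𝟙 (p t z xor q t z) * g t))
    ≡⟨ Σ<.*-distribˡ n ½ _ ⟨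
  Σ< n (λ t → ½ * Σcube n (λ z → 𝟙 (p t z xor q t z) * g t))
    ≡⟨ Σ<.cong-pointwise n per-radius ⟩
  Σ< n (λ t → g t * (ballVolume n t - ballOverlap n t x y)) ∎
  where
  p q : ℕ → Cube n → Bool
  p t z = ham x z ≤ᵇ t
  q t z = ham y z ≤ᵇ t
  halve : ∀ s g → ½ * (((1ℚ + 1ℚ) * s) * g) ≡ g * s
  halve = solve 2 (λ s g → con ½ :* (((con 1ℚ :+ con 1ℚ) :* s) :* g) := g :* s) refl
    where open +-*-Solver
  per-radius : ∀ t → ½ * Σcube n (λ z → 𝟙 (p t z xor q t z) * g t) ≡ g t * (ballVolume n t - ballOverlap n t x y)
  per-radius t = begin
    ½ * Σcube n (λ z → 𝟙 (p t z xor q t z) * g t)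
      ≡⟨ cong (½ *_) (Σcube.*-distribʳ n (g t) _) ⟩
    ½ * (Σcube n (λ z → 𝟙 (p t z xor q t z)) * g t)
      ≡⟨ cong (λ s → ½ * (s * g t)) (ballSymDiff n t x y) ⟩
    ½ * (((1ℚ + 1ℚ) * (ballVolume n t - ballOverlap n t x y)) * g t)
      ≡⟨ halve (ballVolume n t - ballOverlap n t x y) (g t) ⟩
    g t * (ballVolume n t - ballOverlap n t x y) ∎

𝔼 : (n : ℕ) → (Cube n → ℚ) → ℚ
𝔼 n f = ½^ n * Σcube n f

𝔼-isLinear : ∀ n → IsLinear (𝔼 n)
𝔼-isLinear n = record
  { cong-pointwise = λ f≗g → cong (½^ n *_) (Σcube.cong-pointwise n f≗g)
  ; +-distrib      = λ f g → trans (cong (½^ n *_) (Σcube.+-distrib n f g)) (ℚₚ.*-distribˡ-+ (½^ n) _ _)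
  ; *-distribˡ     = λ c f → trans (cong (½^ n *_) (Σcube.*-distribˡ n c f)) (*-Props.x∙yz≈y∙xz (½^ n) c _)
  }

module 𝔼 (n : ℕ) = IsLinear (𝔼-isLinear n)

𝔼-const : ∀ n c → 𝔼 n (λ _ → c) ≡ c
𝔼-const n c = begin
  𝔼 n (λ _ → c)           ≡⟨ 𝔼.cong-pointwise n (λ _ → sym (ℚₚ.*-identityʳ c)) ⟩
  𝔼 n (λ _ → c * 1ℚ)      ≡⟨ 𝔼.*-distribˡ n c (λ _ → 1ℚ) ⟩
  c * 𝔼 n (λ _ → 1ℚ)      ≡⟨ cong (c *_) (½^-Σcube-1 n) ⟩
  c * 1ℚ                  ≡⟨ ℚₚ.*-identityʳ c ⟩
  c                       ∎

𝔼-affine : ∀ n c d (f : Cube n → ℚ) → 𝔼 n (λ y → c * (d - f y)) ≡ c * (d - 𝔼 n f)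
𝔼-affine n c d f = begin
  𝔼 n (λ y → c * (d - f y))         ≡⟨ 𝔼.*-distribˡ n c _ ⟩
  c * 𝔼 n (λ y → d - f y)           ≡⟨ cong (c *_) (𝔼.−-distrib n (λ _ → d) f) ⟩
  c * (𝔼 n (λ _ → d) - 𝔼 n f)       ≡⟨ cong (λ e → c * (e - 𝔼 n f)) (𝔼-const n d) ⟩
  c * (d - 𝔼 n f)                   ∎

λhat0-mean : ∀ n g → λhat0 n g ≡ 𝔼 n (λ x → 𝔼 n (λ y → λG n g x y))
λhat0-mean n g = begin
  ½^ (n ℕ.+ n) * Σcube n (λ x → Σcube n (λ y → λG n g x y))
    ≡⟨ cong (_* Σcube n (λ x → Σcube n (λ y → λG n g x y))) (½^-+ n n) ⟩
  ½^ n * ½^ n * Σcube n (λ x → Σcube n (λ y → λG n g x y))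
    ≡⟨ ℚₚ.*-assoc (½^ n) (½^ n) _ ⟩
  ½^ n * (½^ n * Σcube n (λ x → Σcube n (λ y → λG n g x y)))
    ≡⟨ cong (½^ n *_) (Σcube.*-distribˡ n (½^ n) _) ⟨
  𝔼 n (λ x → 𝔼 n (λ y → λG n g x y)) ∎

𝔼²-ballOverlap : ∀ n t →
  𝔼 n (λ x → 𝔼 n (λ y → ballOverlap n t x y)) ≡ ½^ n * (ballVolume n t * ballVolume n t)
𝔼²-ballOverlap n t = begin
  𝔼 n (λ x → 𝔼 n (λ y → Σcube n (λ z → A x z * A y z)))
    ≡⟨ 𝔼.cong-pointwise n (λ x → sym (Σlist-swap (𝔼-isLinear n) (allCube n) (λ z y → A x z * A y z))) ⟩
  𝔼 n (λ x → Σcube n (λ z → 𝔼 n (λ y → A x z * A y z)))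
    ≡⟨ 𝔼.cong-pointwise n (λ x → Σcube.cong-pointwise n (λ z →
         trans (𝔼.*-distribˡ n (A x z) (λ y → A y z)) (cong (A x z *_) (𝔼-centred z)))) ⟩
  𝔼 n (λ x → Σcube n (λ z → A x z * (½^ n * V)))
    ≡⟨ 𝔼.cong-pointwise n (λ x → trans (Σcube.*-distribʳ n (½^ n * V) (A x))
                                       (cong (_* (½^ n * V)) (Σcube-ham n x (λ d → 𝟙 (d ≤ᵇ t))))) ⟩
  𝔼 n (λ _ → V * (½^ n * V))
    ≡⟨ 𝔼-const n _ ⟩
  V * (½^ n * V)
    ≡⟨ *-Props.x∙yz≈y∙xz V (½^ n) V ⟩
  ½^ n * (V * V) ∎
  where
  V : ℚ
  V = ballVolume n t
  A : Cube n → Cube n → ℚ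
  A x z = 𝟙 (ham x z ≤ᵇ t)
  𝔼-centred : ∀ z → 𝔼 n (λ y → A y z) ≡ ½^ n * V
  𝔼-centred z = cong (½^ n *_) (trans (Σcube.cong-pointwise n (λ y → cong (λ d → 𝟙 (d ≤ᵇ t)) (ham-comm y z)))
                                      (Σcube-ham n z (λ d → 𝟙 (d ≤ᵇ t))))

λhat0-ball : ∀ n g → (∀ i → i ≤ n → 0ℚ ≤ℚ g i) →
  λhat0 n g ≡ Σ< n (λ t → g t * (ballVolume n t - ½^ n * (ballVolume n t * ballVolume n t)))
λhat0-ball n g g≥0 = begin
  λhat0 n g
    ≡⟨ λhat0-mean n g ⟩
  𝔼 n (λ x → 𝔼 n (λ y → λG n g x y))
    ≡⟨ 𝔼.cong-pointwise n (λ x → 𝔼.cong-pointwise n (λ y → λG-ball n g g≥0 x y)) ⟩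
  𝔼 n (λ x → 𝔼 n (λ y → Σ< n (λ t → g t * (V t - ballOverlap n t x y))))
    ≡⟨ 𝔼.cong-pointwise n (λ x → sym (Σ<-swap (𝔼-isLinear n) n _)) ⟩
  𝔼 n (λ x → Σ< n (λ t → 𝔼 n (λ y → g t * (V t - ballOverlap n t x y))))
    ≡⟨ sym (Σ<-swap (𝔼-isLinear n) n _) ⟩
  Σ< n (λ t → 𝔼 n (λ x → 𝔼 n (λ y → g t * (V t - ballOverlap n t x y))))
    ≡⟨ Σ<.cong-pointwise n (λ t →
         trans (𝔼.cong-pointwise n (λ x → 𝔼-affine n (g t) (V t) _)) (𝔼-affine n (g t) (V t) _)) ⟩
  Σ< n (λ t → g t * (V t - 𝔼 n (λ x → 𝔼 n (λ y → ballOverlap n t x y))))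
    ≡⟨ Σ<.cong-pointwise n (λ t → cong (λ o → g t * (V t - o)) (𝔼²-ballOverlap n t)) ⟩
  Σ< n (λ t → g t * (V t - ½^ n * (V t * V t))) ∎
  where
  V : ℕ → ℚ
  V = ballVolume n

ballSpectrum : ℕ → ℕ → ℕ → ℚ
ballSpectrum n t w = Σ< (suc n) (λ k → 𝟙 (k ≤ᵇ t) * Kℚ n k w)

𝓕-ball : ∀ n t (u : Cube n) → 𝓕 n (λ z → 𝟙 (wt z ≤ᵇ t)) u ≡ ballSpectrum n t (wt u)
𝓕-ball n t = 𝓕-radial n (λ k → 𝟙 (k ≤ᵇ t))

ballSpectrum-zero : ∀ n t → ballSpectrum n t 0 ≡ ballVolume n t
ballSpectrum-zero n t = begin
  ballSpectrum n t 0                                  ≡⟨ cong (ballSpectrum n t) (wt-replicate n) ⟨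
  ballSpectrum n t (wt (replicate n false))           ≡⟨ 𝓕-ball n t (replicate n false) ⟨
  𝓕 n (λ z → 𝟙 (wt z ≤ᵇ t)) (replicate n false)       ≡⟨ 𝓕-zero n _ ⟩
  ballVolume n t                                      ∎

ballSpectrum-suc : ∀ m t w → t ≤ m → ballSpectrum (suc m) t (suc w) ≡ Kℚ m t w
ballSpectrum-suc m t w t≤m =
  trans (Σ<-𝟙≤ (suc (suc m)) t _ (s≤s (ℕₚ.m≤n⇒m≤1+n t≤m))) (Σ<-Kℚ-telescope m t w)

ballOverlap-spectral : ∀ n t (x y : Cube n) →
  ballOverlap n t x y ≡ ½^ n * Σ< (suc n) (λ k → ballSpectrum n t k * ballSpectrum n t k * Kℚ n k (ham x y))
ballOverlap-spectral n t x y = begin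
  Σcube n (λ z → 𝟙 (ham x z ≤ᵇ t) * 𝟙 (ham y z ≤ᵇ t))
    ≡⟨ Σcube.cong-pointwise n (λ z → cong₂ (λ d e → B′ d * B′ e) (ham≡wt⊕ x z) (ham≡wt⊕ y z)) ⟩
  Σcube n (λ z → B (x ⊕ z) * B (y ⊕ z))
    ≡⟨ Σcube-correlation n B B x y ⟩
  ½^ n * 𝓕 n (λ u → 𝓕 n B u * 𝓕 n B u) (x ⊕ y)
    ≡⟨ cong (½^ n *_) (𝓕.cong-pointwise n (x ⊕ y) (λ u → cong₂ _*_ (𝓕-ball n t u) (𝓕-ball n t u))) ⟩
  ½^ n * 𝓕 n (λ u → P (wt u) * P (wt u)) (x ⊕ y)
    ≡⟨ cong (½^ n *_) (𝓕-radial n (λ k → P k * P k) (x ⊕ y)) ⟩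
  ½^ n * Σ< (suc n) (λ k → P k * P k * Kℚ n k (wt (x ⊕ y)))
    ≡⟨ cong (λ w → ½^ n * Σ< (suc n) (λ k → P k * P k * Kℚ n k w)) (ham≡wt⊕ x y) ⟨
  ½^ n * Σ< (suc n) (λ k → P k * P k * Kℚ n k (ham x y)) ∎
  where
  B′ : ℕ → ℚ
  B′ d = 𝟙 (d ≤ᵇ t)
  B : Cube n → ℚ
  B z = B′ (wt z)
  P : ℕ → ℚ
  P = ballSpectrum n t

ballOverlap-krawtchouk : ∀ n t → t < n → (x y : Cube n) →
  ballOverlap n t x y ≡ ½^ n * (ballVolume n t * ballVolume n t
                                 + Σ< n (λ k → Kℚ (n ∸ 1) t k * Kℚ (n ∸ 1) t k * Kℚ n (suc k) (ham x y)))
ballOverlap-krawtchouk (suc m) t (s≤s t≤m) x y = begin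
  ballOverlap (suc m) t x y
    ≡⟨ ballOverlap-spectral (suc m) t x y ⟩
  ½^ (suc m) * Σ< (suc (suc m)) (λ k → P k * P k * Kw k)
    ≡⟨ cong (½^ (suc m) *_) (Σ<-suc (suc m) _) ⟩
  ½^ (suc m) * (P 0 * P 0 * 1ℚ + Σ< (suc m) (λ k → P (suc k) * P (suc k) * Kw (suc k)))
    ≡⟨ cong (λ r → ½^ (suc m) * (r + Σ< (suc m) (λ k → P (suc k) * P (suc k) * Kw (suc k))))
            (trans (ℚₚ.*-identityʳ (P 0 * P 0)) (cong (λ v → v * v) (ballSpectrum-zero (suc m) t))) ⟩
  ½^ (suc m) * (V * V + Σ< (suc m) (λ k → P (suc k) * P (suc k) * Kw (suc k)))
    ≡⟨ cong (λ r → ½^ (suc m) * (V * V + r))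
            (Σ<.cong-pointwise (suc m) (λ k → cong (λ q → q * q * Kw (suc k)) (ballSpectrum-suc m t k t≤m))) ⟩
  ½^ (suc m) * (V * V + Σ< (suc m) (λ k → Kℚ m t k * Kℚ m t k * Kw (suc k))) ∎
  where
  P Kw : ℕ → ℚ
  P = ballSpectrum (suc m) t
  Kw k = Kℚ (suc m) k (ham x y)
  V : ℚ
  V = ballVolume (suc m) t

λhat-suc-* : ∀ n g k c →
  λhat n g (suc k) * c ≡ - Σ< n (λ t → ½^ n * (Kℚ (n ∸ 1) t k * Kℚ (n ∸ 1) t k * g t) * c)
λhat-suc-* n g k c = begin
  - (½^ n * Σ< n Q²g) * c               ≡⟨ ℚₚ.neg-distribˡ-* (½^ n * Σ< n Q²g) c ⟨
  - (½^ n * Σ< n Q²g * c)               ≡⟨ cong (λ s → - (s * c)) (Σ<.*-distribˡ n (½^ n) Q²g) ⟨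
  - (Σ< n (λ t → ½^ n * Q²g t) * c)     ≡⟨ cong -_ (Σ<.*-distribʳ n c (λ t → ½^ n * Q²g t)) ⟨
  - Σ< n (λ t → ½^ n * Q²g t * c)       ∎
  where
  Q²g : ℕ → ℚ
  Q²g t = Kℚ (n ∸ 1) t k * Kℚ (n ∸ 1) t k * g t

Σ<-ballDifference : ∀ n g (x y : Cube n) →
  Σ< n (λ t → g t * (ballVolume n t - ballOverlap n t x y))
    ≡ Σ< n (λ t → g t * (ballVolume n t - ½^ n * (ballVolume n t * ballVolume n t)))
      + Σ< n (λ k → λhat n g (suc k) * Kℚ n (suc k) (ham x y))
Σ<-ballDifference n g x y = begin
  Σ< n (λ t → g t * (V t - ballOverlap n t x y))
    ≡⟨ Σ<-cong-< n (λ t t<n → per-radius t (ballOverlap-krawtchouk n t t<n x y)) ⟩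
  Σ< n (λ t → A t + - Σ< n (W t))
    ≡⟨ Σ<.+-distrib n A (λ t → - Σ< n (W t)) ⟩
  Σ< n A + Σ< n (λ t → - Σ< n (W t))
    ≡⟨ cong (Σ< n A +_) (trans (Σ<.neg-distrib n (λ t → Σ< n (W t)))
                               (cong -_ (Σ<-swap (Σ<-isLinear n) n W))) ⟩
  Σ< n A + - Σ< n (λ k → Σ< n (λ t → W t k))
    ≡⟨ cong (Σ< n A +_) (sym (Σ<.neg-distrib n (λ k → Σ< n (λ t → W t k)))) ⟩
  Σ< n A + Σ< n (λ k → - Σ< n (λ t → W t k))
    ≡⟨ cong (Σ< n A +_) (Σ<.cong-pointwise n (λ k → sym (λhat-suc-* n g k (Kw (suc k))))) ⟩
  Σ< n A + Σ< n (λ k → λhat n g (suc k) * Kw (suc k)) ∎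
  where
  V Kw A : ℕ → ℚ
  V = ballVolume n
  Kw k = Kℚ n k (ham x y)
  A t = g t * (V t - ½^ n * (V t * V t))
  Q W : ℕ → ℕ → ℚ
  Q t k = Kℚ (n ∸ 1) t k
  W t k = ½^ n * (Q t k * Q t k * g t) * Kw (suc k)
  expand : ∀ g v h s → g * (v - h * (v * v + s)) ≡ g * (v - h * (v * v)) + - (h * g * s)
  expand = solve 4 (λ g v h s → g :* (v :- h :* (v :* v :+ s))
                               := g :* (v :- h :* (v :* v)) :+ :- (h :* g :* s)) refl
    where open +-*-Solver
  regroup : ∀ h q g c → h * (q * q * g) * c ≡ h * g * (q * q * c)
  regroup = solve 4 (λ h q g c → h :* (q :* q :* g) :* c := h :* g :* (q :* q :* c)) refl
    where open +-*-Solver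
  per-radius : ∀ t {O} → O ≡ ½^ n * (V t * V t + Σ< n (λ k → Q t k * Q t k * Kw (suc k))) →
    g t * (V t - O) ≡ A t + - Σ< n (W t)
  per-radius t refl = trans (expand (g t) (V t) (½^ n) _) (cong (λ r → A t + - r) (sym
    (trans (Σ<.cong-pointwise n (λ k → regroup (½^ n) (Q t k) (g t) (Kw (suc k))))
           (Σ<.*-distribˡ n (½^ n * g t) _))))

proposition6p2 : (n : ℕ) (g : ℕ → ℚ) → (∀ i → i ≤ n → 0ℚ ≤ℚ g i) →
    (x y : Cube n) →
    λG n g x y ≡ Σ[ 0 ⋯ n ] (λ k → λhat n g k * ℤ→ℚ (K n k (ham x y)))
proposition6p2 n g g≥0 x y = begin
  λG n g x y
    ≡⟨ λG-ball n g g≥0 x y ⟩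
  Σ< n (λ t → g t * (V t - ballOverlap n t x y))
    ≡⟨ Σ<-ballDifference n g x y ⟩
  Σ< n (λ t → g t * (V t - ½^ n * (V t * V t))) + Σ< n (λ k → λhat n g (suc k) * Kw (suc k))
    ≡⟨ cong (_+ Σ< n (λ k → λhat n g (suc k) * Kw (suc k))) (λhat0-ball n g g≥0) ⟨
  λhat0 n g + Σ< n (λ k → λhat n g (suc k) * Kw (suc k))
    ≡⟨ cong (_+ Σ< n (λ k → λhat n g (suc k) * Kw (suc k))) (ℚₚ.*-identityʳ (λhat0 n g)) ⟨
  λhat0 n g * 1ℚ + Σ< n (λ k → λhat n g (suc k) * Kw (suc k))
    ≡⟨ Σ<-suc n (λ k → λhat n g k * Kw k) ⟨
  Σ< (suc n) (λ k → λhat n g k * Kw k) ∎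
  where
  V Kw : ℕ → ℚ
  V = ballVolume n
  Kw k = Kℚ n k (ham x y)
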